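{- Let $N$ and $\ell<N$ be positive integers and consider a red/blue coloring of $2^{[N]}$. Suppose that the set of red elements is $\mathcal{A}_1\cup\cdots\cup\mathcal{A}_\ell$, where each $\mathcal{A}_i$ is an antichain consisting of minimal elements of $\mathcal{A}_i\cup\mathcal{A}_{i+1}\cup\cdots\cup\mathcal{A}_\ell$ (with respect to inclusion), $i=1,\dots,\ell$. Then there is a copy of $2^{[N-\ell]}$ in $2^{[N]}$ all of whose elements are blue.
   Context: $2^{[k]}$ is the power set of $[k]=\{1,\dots,k\}$ ordered by inclusion. A copy of a poset $P$ in a poset $P'$ is the image of an injective map $f$ with $x\leq y$ in $P$ iff $f(x)\leq f(y)$ in $P'$. -}

module Defs where

open import Data.Nat using (ℕ)
open import Data.Fin using (Fin; _≤_)
open import Data.Fin.Subset using (Subset; _⊆_)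
open import Data.Product using (Σ; _×_)
open import Relation.Binary.PropositionalEquality using (_≡_)
open import Function.Definitions using (Injective)
open import Function.Bundles using (_⇔_)

Family : ℕ → Set₁
Family N = Subset N → Set

IsAntichain : ∀ {N} → Family N → Set
IsAntichain {N} 𝒜 = ∀ (X Y : Subset N) → 𝒜 X → 𝒜 Y → X ⊆ Y → X ≡ Y

IsMinimalIn : ∀ {N} → Family N → Subset N → Set
IsMinimalIn {N} ℬ X = ℬ X × (∀ (Y : Subset N) → ℬ Y → Y ⊆ X → Y ≡ X)

-- 𝒜_i ∪ 𝒜_{i+1} ∪ ... ∪ 𝒜_ℓ  (indices 0-based: Fin ℓ)
UnionFrom : ∀ {N ℓ} → (Fin ℓ → Family N) → Fin ℓ → Family N
UnionFrom {N} {ℓ} 𝒜 i X = Σ (Fin ℓ) (λ j → i ≤ j × 𝒜 j X)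

IsCopy : ∀ {M N} → (Subset M → Subset N) → Set
IsCopy {M} f = Injective _≡_ _≡_ f × (∀ (x y : Subset M) → (x ⊆ y) ⇔ (f x ⊆ f y))

-- Give every set a rank: 0 if it is blue, i + 1 if it lies in 𝒜ᵢ. Minimality of 𝒜ᵢ in
-- 𝒜ᵢ ∪ ⋯ ∪ 𝒜_ℓ makes the rank of a red set exceed the rank of each of its proper subsets,
-- so the height h(Z) = max {rank W : W ⊆ Z} is monotone, at most ℓ, and at a red Z strictly
-- above h of any proper subset. Split [N] as [ℓ] ⊎ [N - ℓ] and send x ⊆ [N - ℓ] to
-- {1, …, k} ∪ x for the least k with h({1, …, k} ∪ x) ≤ k. This k is monotone in x, so the
-- map is a copy of 2^[N-ℓ], and a red image would give h({1, …, k-1} ∪ x) ≤ k - 1,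
-- contradicting the choice of k.
module Submission where

open import Defs
open import Data.Nat using (ℕ; zero; suc; _+_; _∸_; _≤_; _<_; z≤n; s≤s; s≤s⁻¹; _⊔_; _≤?_)
open import Data.Nat.Properties
  using (≤-refl; ≤-trans; <-≤-trans; <-irrefl; <⇒≤; <⇒≱; ≰⇒>; m≤n⇒m≤n⊔o; m≤n⇒m≤o⊔n; ⊔-lub; m+[n∸m]≡n)
open import Data.Bool using (Bool; true; false)
open import Data.Bool.Properties using (¬-not)
open import Data.Fin using (Fin; toℕ)
open import Data.Fin.Properties using (toℕ<n)
open import Data.Fin.Subset using (Subset; _⊆_; inside; outside)
open import Data.Fin.Subset.Properties using (drop-∷-⊆; out⊆; in⊆in; ⊆-refl; ⊆-trans; ⊆-reflexive)
open import Data.Vec.Base using ([]; _∷_; _++_; here)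
open import Data.Vec.Properties using (++-injectiveʳ)
open import Data.Product using (Σ; _×_; _,_; proj₁; proj₂)
open import Data.Empty using (⊥-elim)
open import Relation.Binary.PropositionalEquality using (_≡_; refl; sym)
open import Relation.Nullary using (¬_; yes; no)
open import Relation.Unary using (Pred; Decidable)
open import Function using (_∘′_; flip)
open import Function.Bundles using (_⇔_; Equivalence; mk⇔)

inside∷⊈outside∷ : ∀ {n} {p q : Subset n} → ¬ (inside ∷ p ⊆ outside ∷ q)
inside∷⊈outside∷ p⊆q with p⊆q here
... | ()

⊆-++⁺ : ∀ {n m} (u v : Subset n) {x y : Subset m} → u ⊆ v → x ⊆ y → u ++ x ⊆ v ++ y
⊆-++⁺ []            []            _   x⊆y = x⊆y
⊆-++⁺ (outside ∷ u) (_ ∷ v)       u⊆v x⊆y = out⊆ (⊆-++⁺ u v (drop-∷-⊆ u⊆v) x⊆y)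
⊆-++⁺ (inside ∷ u)  (inside ∷ v)  u⊆v x⊆y = in⊆in (⊆-++⁺ u v (drop-∷-⊆ u⊆v) x⊆y)
⊆-++⁺ (inside ∷ u)  (outside ∷ v) u⊆v _   = ⊥-elim (inside∷⊈outside∷ u⊆v)

⊆-++⁻ˡ : ∀ {n m} (u v : Subset n) {x y : Subset m} → u ++ x ⊆ v ++ y → u ⊆ v
⊆-++⁻ˡ []            []            _ = ⊆-refl
⊆-++⁻ˡ (outside ∷ u) (_ ∷ v)       h = out⊆ (⊆-++⁻ˡ u v (drop-∷-⊆ h))
⊆-++⁻ˡ (inside ∷ u)  (inside ∷ v)  h = in⊆in (⊆-++⁻ˡ u v (drop-∷-⊆ h))
⊆-++⁻ˡ (inside ∷ u)  (outside ∷ v) h = ⊥-elim (inside∷⊈outside∷ h)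

⊆-++⁻ʳ : ∀ {n m} (u v : Subset n) {x y : Subset m} → u ++ x ⊆ v ++ y → x ⊆ y
⊆-++⁻ʳ []      []      h = h
⊆-++⁻ʳ (_ ∷ u) (_ ∷ v) h = ⊆-++⁻ʳ u v (drop-∷-⊆ h)

initial : (n k : ℕ) → Subset n
initial zero    _       = []
initial (suc n) zero    = outside ∷ initial n zero
initial (suc n) (suc k) = inside ∷ initial n k

initial-mono : ∀ n {j k} → j ≤ k → initial n j ⊆ initial n k
initial-mono zero                       _         = ⊆-refl
initial-mono (suc n) {zero}  {zero}    _         = out⊆ ⊆-refl
initial-mono (suc n) {zero}  {suc k}   _         = out⊆ (initial-mono n z≤n)
initial-mono (suc n) {suc j} {suc k}   (s≤s j≤k) = in⊆in (initial-mono n j≤k)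

initial-suc⊈initial : ∀ n j → j < n → ¬ (initial n (suc j) ⊆ initial n j)
initial-suc⊈initial (suc n) zero    _         = inside∷⊈outside∷
initial-suc⊈initial (suc n) (suc j) (s≤s j<n) = initial-suc⊈initial n j j<n ∘′ drop-∷-⊆

maxBelow : ∀ {n} → (Subset n → ℕ) → Subset n → ℕ
maxBelow g []            = g []
maxBelow g (outside ∷ Z) = maxBelow (λ W → g (outside ∷ W)) Z
maxBelow g (inside ∷ Z)  = maxBelow (λ W → g (outside ∷ W)) Z ⊔ maxBelow (λ W → g (inside ∷ W)) Z

≤-maxBelow : ∀ {n} (g : Subset n → ℕ) {W Z : Subset n} → W ⊆ Z → g W ≤ maxBelow g Z
≤-maxBelow g {[]}          {[]}          _   = ≤-refl
≤-maxBelow g {outside ∷ W} {outside ∷ Z} W⊆Z = ≤-maxBelow _ (drop-∷-⊆ W⊆Z)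
≤-maxBelow g {inside ∷ W}  {outside ∷ Z} W⊆Z = ⊥-elim (inside∷⊈outside∷ W⊆Z)
≤-maxBelow g {outside ∷ W} {inside ∷ Z}  W⊆Z = m≤n⇒m≤n⊔o _ (≤-maxBelow _ (drop-∷-⊆ W⊆Z))
≤-maxBelow g {inside ∷ W}  {inside ∷ Z}  W⊆Z = m≤n⇒m≤o⊔n _ (≤-maxBelow _ (drop-∷-⊆ W⊆Z))

maxBelow-lub : ∀ {n} (g : Subset n → ℕ) (Z : Subset n) {b : ℕ} →
               (∀ W → W ⊆ Z → g W ≤ b) → maxBelow g Z ≤ b
maxBelow-lub g []            h = h [] ⊆-refl
maxBelow-lub g (outside ∷ Z) h = maxBelow-lub _ Z (λ W W⊆Z → h (outside ∷ W) (out⊆ W⊆Z))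
maxBelow-lub g (inside ∷ Z)  h =
  ⊔-lub (maxBelow-lub _ Z (λ W W⊆Z → h (outside ∷ W) (out⊆ W⊆Z)))
        (maxBelow-lub _ Z (λ W W⊆Z → h (inside ∷ W) (in⊆in W⊆Z)))

maxBelow-mono : ∀ {n} (g : Subset n → ℕ) {Y Z : Subset n} → Y ⊆ Z → maxBelow g Y ≤ maxBelow g Z
maxBelow-mono g {Y} Y⊆Z = maxBelow-lub g Y (λ W W⊆Y → ≤-maxBelow g (⊆-trans W⊆Y Y⊆Z))

-- least P? n is the least k ≤ n satisfying P, and n if there is none.
least : ∀ {p} {P : Pred ℕ p} → Decidable P → ℕ → ℕ
least P? zero    = zero
least P? (suc n) with P? zero
... | yes _ = zero
... | no  _ = suc (least (λ k → P? (suc k)) n)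

least-≤ : ∀ {p} {P : Pred ℕ p} (P? : Decidable P) n → least P? n ≤ n
least-≤ P? zero    = z≤n
least-≤ P? (suc n) with P? zero
... | yes _ = z≤n
... | no  _ = s≤s (least-≤ (λ k → P? (suc k)) n)

least-satisfies : ∀ {p} {P : Pred ℕ p} (P? : Decidable P) n → P n → P (least P? n)
least-satisfies P? zero    Pn = Pn
least-satisfies P? (suc n) Pn with P? zero
... | yes P0 = P0
... | no  _  = least-satisfies (λ k → P? (suc k)) n Pn

least-minimal : ∀ {p} {P : Pred ℕ p} (P? : Decidable P) n {k} → P k → least P? n ≤ k
least-minimal P? zero    _  = z≤n
least-minimal P? (suc n) {k} Pk with P? zero
... | yes _  = z≤n
least-minimal P? (suc n) {zero}  Pk | no ¬P0 = ⊥-elim (¬P0 Pk)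
least-minimal P? (suc n) {suc k} Pk | no _   = s≤s (least-minimal (λ j → P? (suc j)) n Pk)

module BlueCube
  {ℓ m : ℕ} (red : Subset (ℓ + m) → Set) (rank : Subset (ℓ + m) → ℕ)
  (rank≤ℓ : ∀ Z → rank Z ≤ ℓ)
  (red⇒rank>0 : ∀ {Z} → red Z → 0 < rank Z)
  (red⇒rank-strict : ∀ {W Z} → red Z → W ⊆ Z → ¬ (Z ⊆ W) → rank W < rank Z)
  where

  height : Subset (ℓ + m) → ℕ
  height = maxBelow rank

  height≤ℓ : ∀ Z → height Z ≤ ℓ
  height≤ℓ Z = maxBelow-lub rank Z (λ W _ → rank≤ℓ W)

  height-drops-below-red : ∀ {Y Z j} → red Z → height Z ≤ suc j →
                           Y ⊆ Z → ¬ (Z ⊆ Y) → height Y ≤ j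
  height-drops-below-red {Y} {Z} redZ hZ Y⊆Z Z⊈Y = maxBelow-lub rank Y λ W W⊆Y →
    s≤s⁻¹ (<-≤-trans (red⇒rank-strict redZ (⊆-trans W⊆Y Y⊆Z) (Z⊈Y ∘′ flip ⊆-trans W⊆Y))
                     (≤-trans (≤-maxBelow rank ⊆-refl) hZ))

  lift : Subset m → ℕ → Subset (ℓ + m)
  lift x k = initial ℓ k ++ x

  Settled : Subset m → Pred ℕ _
  Settled x k = height (lift x k) ≤ k

  settled? : ∀ x → Decidable (Settled x)
  settled? x k = height (lift x k) ≤? k

  level : Subset m → ℕ
  level x = least (settled? x) ℓ

  embed : Subset m → Subset (ℓ + m)
  embed x = lift x (level x)

  settled-level : ∀ x → Settled x (level x)
  settled-level x = least-satisfies (settled? x) ℓ (height≤ℓ (lift x ℓ))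

  level-mono : ∀ {x y} → x ⊆ y → level x ≤ level y
  level-mono {x} {y} x⊆y = least-minimal (settled? x) ℓ
    (≤-trans (maxBelow-mono rank (⊆-++⁺ (initial ℓ (level y)) _ ⊆-refl x⊆y)) (settled-level y))

  blue-at-least-settled : ∀ x k → k ≤ ℓ → Settled x k → (∀ {j} → Settled x j → k ≤ j) →
                          ¬ red (lift x k)
  blue-at-least-settled x zero _ settled _ redZ =
    <⇒≱ (red⇒rank>0 redZ) (≤-trans (≤-maxBelow rank ⊆-refl) settled)
  blue-at-least-settled x (suc j) k≤ℓ settled minimal redZ = <-irrefl refl (minimal settled-j)
    where
      settled-j : Settled x j
      settled-j = height-drops-below-red redZ settled
        (⊆-++⁺ (initial ℓ j) _ (initial-mono ℓ (<⇒≤ ≤-refl)) ⊆-refl)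
        (λ h → initial-suc⊈initial ℓ j k≤ℓ (⊆-++⁻ˡ (initial ℓ (suc j)) (initial ℓ j) h))

  embed-blue : ∀ x → ¬ red (embed x)
  embed-blue x = blue-at-least-settled x (level x) (least-≤ (settled? x) ℓ) (settled-level x)
                                        (least-minimal (settled? x) ℓ)

  embed-mono : ∀ {x y} → x ⊆ y → embed x ⊆ embed y
  embed-mono {x} {y} x⊆y = ⊆-++⁺ (initial ℓ (level x)) _ (initial-mono ℓ (level-mono {x} {y} x⊆y)) x⊆y

  embed-isCopy : IsCopy embed
  embed-isCopy = (λ {x} {y} → ++-injectiveʳ (initial ℓ (level x)) (initial ℓ (level y)))
               , λ x y → mk⇔ embed-mono (⊆-++⁻ʳ (initial ℓ (level x)) (initial ℓ (level y)))

module LayerRank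
  {ℓ N : ℕ} (colour : Subset N → Bool) (𝒜 : Fin ℓ → Family N)
  (red⇔layered : ∀ X → (colour X ≡ true) ⇔ Σ (Fin ℓ) (λ i → 𝒜 i X))
  (layer-minimal : ∀ i X → 𝒜 i X → IsMinimalIn (UnionFrom 𝒜 i) X)
  where

  Red : Subset N → Set
  Red X = colour X ≡ true

  layer : ∀ {X} → Red X → Fin ℓ
  layer {X} redX = proj₁ (Equivalence.to (red⇔layered X) redX)

  ∈layer : ∀ {X} (redX : Red X) → 𝒜 (layer redX) X
  ∈layer {X} redX = proj₂ (Equivalence.to (red⇔layered X) redX)

  -- The layer is only available once colour X is known to be true, hence the Bool argument.
  rankOf : (b : Bool) → (b ≡ true → Fin ℓ) → ℕ
  rankOf true  layerOf = suc (toℕ (layerOf refl))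
  rankOf false _       = 0

  rankOf-≤ : ∀ b layerOf → rankOf b layerOf ≤ ℓ
  rankOf-≤ true  layerOf = toℕ<n (layerOf refl)
  rankOf-≤ false _       = z≤n

  rankOf-true : ∀ b layerOf (e : b ≡ true) → rankOf b layerOf ≡ suc (toℕ (layerOf e))
  rankOf-true true _ refl = refl

  rankOf-< : ∀ b layerOf {c} → (∀ e → toℕ (layerOf e) < c) → rankOf b layerOf < suc c
  rankOf-< true  _ below = s≤s (below refl)
  rankOf-< false _ _     = s≤s z≤n

  rank : Subset N → ℕ
  rank X = rankOf (colour X) layer

  rank≤ℓ : ∀ X → rank X ≤ ℓ
  rank≤ℓ X = rankOf-≤ (colour X) layer

  red⇒rank>0 : ∀ {Z} → Red Z → 0 < rank Z
  red⇒rank>0 {Z} redZ rewrite rankOf-true (colour Z) layer redZ = s≤s z≤n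

  layer-strict : ∀ {W Z} (redZ : Red Z) → W ⊆ Z → ¬ (Z ⊆ W) →
                 (redW : Red W) → toℕ (layer redW) < toℕ (layer redZ)
  layer-strict {W} {Z} redZ W⊆Z Z⊈W redW with toℕ (layer redZ) ≤? toℕ (layer redW)
  ... | no  ≰ = ≰⇒> ≰
  ... | yes Z≤W = ⊥-elim (Z⊈W (⊆-reflexive (sym W≡Z)))
    where
      W≡Z : W ≡ Z
      W≡Z = proj₂ (layer-minimal (layer redZ) Z (∈layer redZ)) W (layer redW , Z≤W , ∈layer redW) W⊆Z

  red⇒rank-strict : ∀ {W Z} → Red Z → W ⊆ Z → ¬ (Z ⊆ W) → rank W < rank Z
  red⇒rank-strict {W} {Z} redZ W⊆Z Z⊈W rewrite rankOf-true (colour Z) layer redZ =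
    rankOf-< (colour W) layer (layer-strict redZ W⊆Z Z⊈W)

layered⇒blueCube :
  (ℓ m : ℕ) (colour : Subset (ℓ + m) → Bool) (𝒜 : Fin ℓ → Family (ℓ + m)) →
  (∀ X → (colour X ≡ true) ⇔ Σ (Fin ℓ) (λ i → 𝒜 i X)) →
  (∀ i X → 𝒜 i X → IsMinimalIn (UnionFrom 𝒜 i) X) →
  Σ (Subset m → Subset (ℓ + m)) (λ f → IsCopy f × (∀ x → colour (f x) ≡ false))
layered⇒blueCube ℓ m colour 𝒜 red⇔layered layer-minimal =
  embed , embed-isCopy , λ x → ¬-not (embed-blue x)
  where
    open LayerRank colour 𝒜 red⇔layered layer-minimal
    open BlueCube Red rank rank≤ℓ red⇒rank>0 red⇒rank-strict

mainTheorem9 : (N ℓ : ℕ) → 0 < ℓ → ℓ < N →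
    (colour : Subset N → Bool) →
    (𝒜 : Fin ℓ → Family N) →
    (∀ (X : Subset N) → (colour X ≡ true) ⇔ Σ (Fin ℓ) (λ i → 𝒜 i X)) →
    (∀ (i : Fin ℓ) → IsAntichain (𝒜 i) ×
        (∀ (X : Subset N) → 𝒜 i X → IsMinimalIn (UnionFrom 𝒜 i) X)) →
    Σ (Subset (N ∸ ℓ) → Subset N)
      (λ f → IsCopy f × (∀ (x : Subset (N ∸ ℓ)) → colour (f x) ≡ false))
mainTheorem9 N ℓ _ ℓ<N colour 𝒜 red⇔layered layers
  with N ∸ ℓ | m+[n∸m]≡n (<⇒≤ ℓ<N)
... | m | refl = layered⇒blueCube ℓ m colour 𝒜 red⇔layered (λ i → proj₂ (layers i))
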